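{- Let $q(x,y)$ be a primitive integral binary quadratic form of discriminant $D<0$, let $\omega\in\mathbb{Z}$ and $Q(x,y)=q(x,y)-\omega D$. Then for every prime power $p^n$ one has $\rho_Q(p^n)\le16\,p^{n(2-1/2)}$.
   Context: $\rho_Q(a)$ is the number of $(x,y)\in(\mathbb{Z}/a\mathbb{Z})^2$ with $Q(x,y)\equiv0\pmod a$. -}

module Defs where

open import Data.Nat as ℕ using (ℕ)
open import Data.Nat.Divisibility using (_∣?_)
open import Data.Nat.GCD using (gcd)
open import Data.Integer as ℤ using (ℤ; +_; ∣_∣)
open import Data.List using (List; length; filterᵇ; upTo; concatMap; map)
open import Data.Product using (_×_; _,_)
open import Relation.Nullary using (does)
open import Relation.Binary.PropositionalEquality using (_≡_)

record BQF : Set where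
  constructor bqf
  field
    a b c : ℤ
open BQF public

evalForm : BQF → ℤ → ℤ → ℤ
evalForm q x y = a q ℤ.* x ℤ.* x ℤ.+ b q ℤ.* x ℤ.* y ℤ.+ c q ℤ.* y ℤ.* y

disc : BQF → ℤ
disc q = b q ℤ.* b q ℤ.- + 4 ℤ.* a q ℤ.* c q

Primitive : BQF → Set
Primitive q = gcd (gcd ∣ a q ∣ ∣ b q ∣) ∣ c q ∣ ≡ 1

shiftedForm : BQF → ℤ → ℤ → ℤ → ℤ
shiftedForm q ω x y = evalForm q x y ℤ.- ω ℤ.* disc q

-- all pairs (x,y) with 0 ≤ x,y < m, i.e. representatives of (ℤ/mℤ)²
pairsMod : ℕ → List (ℕ × ℕ)
pairsMod m = concatMap (λ x → map (λ y → (x , y)) (upTo m)) (upTo m)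

-- ρ_Q(m) = #{(x,y) ∈ (ℤ/mℤ)² : Q(x,y) ≡ 0 mod m}
-- (m ∣ z in ℤ is, by definition in the stdlib, m ∣ ∣z∣ in ℕ)
ρ : (ℤ → ℤ → ℤ) → ℕ → ℕ
ρ Q m = length (filterᵇ (λ { (x , y) → does (m ∣? ∣ Q (+ x) (+ y) ∣) }) (pairsMod m))

-- Write n = (j + 1) + k with j ≤ k ≤ j + 1. Since q is primitive, one of
-- c, a, a − b + c = q(1, −1) is prime to p, so after the linear change of
-- coordinates (x, y) ↦ (π, σ) = (x, y), (y, x) or (x + y, y) the form becomes
-- α σ² + β(π) σ + γ(π) with p ∤ α. For each of the < 2m values of π we count
-- the roots σ modulo m: those congruent to a fixed root t₀ modulo p^(j+1) are
-- at most p^k; every other root t makes p^(k+1) divide α t + α t₀ + β, and these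
-- form one residue class modulo p^(k+1), so there are at most p^j of them. Hence
-- ρ_Q(m) ≤ 2m(p^k + p^j) ≤ 4m·p^k, and squaring with p^(2k) ≤ m gives the claim.
module Submission where

open import Defs

module Counting where

  open import Data.Nat using (ℕ; zero; suc; _+_; _*_; _≤_; _<_; z≤n; s≤s; _≟_)
  open import Data.Nat.Properties
    using (+-mono-≤; ≤∧≢⇒<; m<1+n⇒m≤n; +-suc; *-identityʳ; ≤-trans; module ≤-Reasoning)
  open import Data.List using (List; []; _∷_; length; filter; map)
  open import Data.List.Relation.Unary.All as All using (All; []; _∷_)
  import Data.List.Relation.Unary.All.Properties as All
  open import Data.List.Relation.Unary.AllPairs as AllPairs using ([]; _∷_)
  import Data.List.Relation.Unary.AllPairs.Properties as AllPairs
  open import Data.List.Relation.Unary.Unique.Propositional using (Unique)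
  import Data.List.Relation.Unary.Unique.Propositional.Properties as Unique
  open import Data.List.Relation.Binary.Sublist.Propositional.Properties
    using (filter-⊆; filter⁺; length-mono-≤)
  open import Data.Product using (_,_)
  open import Relation.Binary.PropositionalEquality using (_≡_; refl; cong; sym; trans; subst)
  open import Relation.Nullary using (¬_; yes; no; contradiction)
  open import Level using (0ℓ)
  open import Relation.Unary using (Pred; Decidable)
  open import Relation.Unary.Properties using (∁?)

  module _ {A : Set} where

    length-split : {P : Pred A 0ℓ} (P? : Decidable P) (xs : List A) →
      length xs ≡ length (filter P? xs) + length (filter (∁? P?) xs)
    length-split P? [] = refl
    length-split P? (x ∷ xs) with P? x
    ... | yes _ = cong suc (length-split P? xs)
    ... | no _  = trans (cong suc (length-split P? xs)) (sym (+-suc _ _))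

    fibre : (π : A → ℕ) (r : ℕ) → List A → List A
    fibre π r = filter (λ z → π z ≟ r)

    fibre-count : (π : A → ℕ) (B R : ℕ) (xs : List A) → All (λ z → π z < R) xs →
      (∀ r → length (fibre π r xs) ≤ B) → length xs ≤ R * B
    fibre-count π B zero [] _ _ = z≤n
    fibre-count π B zero (_ ∷ _) (() ∷ _) _
    fibre-count π B (suc R) xs π<1+R fibres≤B = begin
        length xs                                      ≡⟨ length-split top? xs ⟩
        length (fibre π R xs) + length rest            ≤⟨ +-mono-≤ (fibres≤B R) rest≤R*B ⟩
        B + R * B                                      ∎
      where
      open ≤-Reasoning
      top? : Decidable (λ z → π z ≡ R)
      top? z = π z ≟ R
      rest : List A
      rest = filter (∁? top?) xs
      π<R : All (λ z → π z < R) rest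
      π<R = All.zipWith (λ (π<1+R , π≢R) → ≤∧≢⇒< (m<1+n⇒m≤n π<1+R) π≢R)
        (All.filter⁺ (∁? top?) π<1+R , All.all-filter (∁? top?) xs)
      rest≤R*B : length rest ≤ R * B
      rest≤R*B = fibre-count π B R rest π<R λ r → ≤-trans
        (length-mono-≤ (filter⁺ (λ z → π z ≟ r) (λ z → π z ≟ r) (λ { refl e → e })
          (filter-⊆ (∁? top?) xs)))
        (fibres≤B r)

    map-injectiveOn : {B : Set} {P : Pred A 0ℓ} (f : A → B) {xs : List A} → Unique xs → All P xs →
      (∀ {a b} → P a → P b → f a ≡ f b → a ≡ b) → Unique (map f xs)
    map-injectiveOn {P = P} f xs! Pxs inj = AllPairs.map⁺ (go xs! Pxs)
      where
      go : ∀ {ys} → Unique ys → All P ys → AllPairs.AllPairs (λ a b → ¬ f a ≡ f b) ys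
      go [] [] = []
      go (y∉ys ∷ ys!) (Py ∷ Pys) =
        All.zipWith (λ (y≢z , Pz) fy≡fz → y≢z (inj Py Pz fy≡fz)) (y∉ys , Pys) ∷ go ys! Pys

  unique-constant : {A : Set} {r : A} {ys : List A} → Unique ys → All (_≡ r) ys → length ys ≤ 1
  unique-constant [] [] = z≤n
  unique-constant (_ ∷ []) _ = s≤s z≤n
  unique-constant ((y≢z ∷ _) ∷ _) (y≡r ∷ z≡r ∷ _) = contradiction (trans y≡r (sym z≡r)) y≢z

  unique-bounded : (N : ℕ) {xs : List ℕ} → Unique xs → All (_< N) xs → length xs ≤ N
  unique-bounded N {xs} xs! xs<N =
    subst (length xs ≤_) (*-identityʳ N) (fibre-count (λ z → z) 1 N xs xs<N at-most-one)
    where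
    at-most-one : ∀ r → length (fibre (λ z → z) r xs) ≤ 1
    at-most-one r = unique-constant (Unique.filter⁺ (_≟ r) xs!) (All.all-filter (_≟ r) xs)

-- Divisibility by prime powers, and congruences between naturals. Integer
-- divisibility is the library's unsigned one: + k ∣ℤ z unfolds to k ∣ ∣ z ∣,
-- exactly the condition counted by ρ.
module Congruences where

  open import Data.Nat using (zero; suc; _+_; _*_; _^_; _∸_; _≤_; NonZero)
  open import Data.Nat.Properties
    using (*-comm; *-assoc; +-suc; ≤-total; m+[n∸m]≡n; ^-distribˡ-+-*; m^n≢0)
  open import Data.Nat.Divisibility
    using (_∣_; divides; _∣?_; ∣-trans; 1∣_; m∣m*n; n∣m*n; *-monoʳ-∣; *-cancelˡ-∣)
  open import Data.Nat.DivMod using (_/_; _%_; [m+kn]%n≡m%n; m≡m%n+[m/n]*n)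
  open import Data.Nat.Primality using (Prime; euclidsLemma; prime⇒nonZero)
  open import Data.Integer as ℤ using (+_; ∣_∣)
  import Data.Integer.Properties as ℤ
  import Data.Integer.Divisibility.Signed as Signed
  open import Data.Integer.Divisibility using () renaming (_∣_ to _∣ℤ_)
  open import Data.Sum using (_⊎_; inj₁; inj₂)
  open import Relation.Binary.PropositionalEquality
  open import Relation.Nullary using (¬_; yes; no; contradiction)
  open import Data.Nat.Tactic.RingSolver using (solve-∀)

  prime-power-cancel : ∀ {p a} → Prime p → ¬ p ∣ a → ∀ e d → p ^ e ∣ a * d → p ^ e ∣ d
  prime-power-cancel p-prime p∤a zero d _ = 1∣ d
  prime-power-cancel {p} {a} p-prime p∤a (suc e) d pᵉ⁺¹∣ad
    with euclidsLemma a d p-prime (∣-trans (m∣m*n (p ^ e)) pᵉ⁺¹∣ad)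
  ... | inj₁ p∣a = contradiction p∣a p∤a
  ... | inj₂ (divides d′ refl) = subst (p * p ^ e ∣_) (*-comm p d′) (*-monoʳ-∣ p pᵉ∣d′)
    where
    instance _ = prime⇒nonZero p-prime
    pᵉ∣d′ : p ^ e ∣ d′
    pᵉ∣d′ = prime-power-cancel p-prime p∤a e d′
      (*-cancelˡ-∣ p (subst (p * p ^ e ∣_) (rearrange a d′ p) pᵉ⁺¹∣ad))
      where
      rearrange : ∀ a d p → a * (d * p) ≡ p * (a * d)
      rearrange = solve-∀

  prime-power-split : ∀ {p} → Prime p → ∀ j i U W →
    p ^ (j + i) ∣ U * W → (p ^ j ∣ U) ⊎ (p ^ suc i ∣ W)
  prime-power-split p-prime zero i U W _ = inj₁ (1∣ U)
  prime-power-split {p} p-prime (suc j) i U W pʲ⁺¹⁺ⁱ∣UW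
    with prime-power-split p-prime j (suc i) U W
           (subst (λ e → p ^ e ∣ U * W) (sym (+-suc j i)) pʲ⁺¹⁺ⁱ∣UW)
  ... | inj₂ pⁱ⁺²∣W = inj₂ (∣-trans (n∣m*n p) pⁱ⁺²∣W)
  ... | inj₁ (divides U′ refl) with p ∣? U′
  ...   | yes (divides u refl) = inj₁ (divides u (*-assoc u p (p ^ j)))
  ...   | no p∤U′ =
    inj₂ (prime-power-cancel p-prime p∤U′ (suc i) W (*-cancelˡ-∣ (p ^ j) pʲpⁱ⁺¹∣pʲU′W))
    where
    instance _ = m^n≢0 p j {{prime⇒nonZero p-prime}}
    rearrange : ∀ u q w → u * q * w ≡ q * (u * w)
    rearrange = solve-∀
    pʲpⁱ⁺¹∣pʲU′W : p ^ j * p ^ suc i ∣ p ^ j * (U′ * W)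
    pʲpⁱ⁺¹∣pʲU′W = subst₂ _∣_
      (trans (cong (p ^_) (sym (+-suc j i))) (^-distribˡ-+-* p j (suc i)))
      (rearrange U′ (p ^ j) W) pʲ⁺¹⁺ⁱ∣UW

  ∣ℤ-difference : ∀ {k} x y → k ∣ℤ x → k ∣ℤ y → k ∣ℤ x ℤ.- y
  ∣ℤ-difference {k} x y k∣x k∣y =
    Signed.∣⇒∣ᵤ (Signed.∣m∣n⇒∣m-n (Signed.∣ᵤ⇒∣ {k} {x} k∣x) (Signed.∣ᵤ⇒∣ {k} {y} k∣y))

  ∣ℤ-sum : ∀ {k} x y → k ∣ℤ x → k ∣ℤ y → k ∣ℤ x ℤ.+ y
  ∣ℤ-sum {k} x y k∣x k∣y =
    Signed.∣⇒∣ᵤ (Signed.∣m∣n⇒∣m+n (Signed.∣ᵤ⇒∣ {k} {x} k∣x) (Signed.∣ᵤ⇒∣ {k} {y} k∣y))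

  ∣+m-+n∣≡n∸m : ∀ {m n} → m ≤ n → ∣ + m ℤ.- + n ∣ ≡ n ∸ m
  ∣+m-+n∣≡n∸m {m} {n} m≤n = trans (cong ∣_∣ (ℤ.[+m]-[+n]≡m⊖n m n)) (ℤ.∣⊖∣-≤ m≤n)

  ∸-divisible⇒%≡ : ∀ M .{{_ : NonZero M}} {r y} → r ≤ y → M ∣ y ∸ r → y % M ≡ r % M
  ∸-divisible⇒%≡ M {r} {y} r≤y (divides k y∸r≡kM) = begin
    y % M               ≡⟨ cong (_% M) (sym (m+[n∸m]≡n r≤y)) ⟩
    (r + (y ∸ r)) % M   ≡⟨ cong (λ d → (r + d) % M) y∸r≡kM ⟩
    (r + k * M) % M     ≡⟨ [m+kn]%n≡m%n r k M ⟩
    r % M               ∎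
    where open ≡-Reasoning

  congruent⇒%≡ : ∀ M .{{_ : NonZero M}} y r → + M ∣ℤ + y ℤ.- + r → y % M ≡ r % M
  congruent⇒%≡ M y r M∣y-r with ≤-total r y
  ... | inj₁ r≤y = ∸-divisible⇒%≡ M r≤y
    (subst (M ∣_) (trans (ℤ.∣i-j∣≡∣j-i∣ (+ y) (+ r)) (∣+m-+n∣≡n∸m r≤y)) M∣y-r)
  ... | inj₂ y≤r = sym (∸-divisible⇒%≡ M y≤r (subst (M ∣_) (∣+m-+n∣≡n∸m y≤r) M∣y-r))

  %-/-injective : ∀ M .{{_ : NonZero M}} {a b} → a % M ≡ b % M → a / M ≡ b / M → a ≡ b
  %-/-injective M {a} {b} a%≡b% a/≡b/ = begin
    a                     ≡⟨ m≡m%n+[m/n]*n a M ⟩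
    a % M + (a / M) * M   ≡⟨ cong₂ (λ s t → s + t * M) a%≡b% a/≡b/ ⟩
    b % M + (b / M) * M   ≡⟨ sym (m≡m%n+[m/n]*n b M) ⟩
    b                     ∎
    where open ≡-Reasoning

module Roots where

  open Counting
  open Congruences
  open import Data.Nat using (ℕ; suc; _+_; _*_; _^_; _≤_; _<_; NonZero; z≤n)
  open import Data.Nat.Properties
    using (m^n≢0; ^-distribˡ-+-*; *-comm; +-suc; +-mono-≤; module ≤-Reasoning)
  open import Data.Nat.Divisibility using (_∣_; _∣?_)
  open import Data.Nat.DivMod using (_/_; m<n*o⇒m/o<n)
  open import Data.Nat.Primality using (Prime; prime⇒nonZero)
  open import Data.Integer as ℤ using (ℤ; +_; ∣_∣)
  import Data.Integer.Properties as ℤ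
  open import Data.Integer.Divisibility using () renaming (_∣_ to _∣ℤ_)
  open import Data.Integer.Tactic.RingSolver using (solve-∀)
  open import Data.List using (List; []; _∷_; length; map; filter)
  open import Data.List.Properties using (length-map)
  open import Data.List.Relation.Unary.All as All using (All; []; _∷_)
  import Data.List.Relation.Unary.All.Properties as All
  open import Data.List.Relation.Unary.Unique.Propositional using (Unique)
  import Data.List.Relation.Unary.Unique.Propositional.Properties as Unique
  open import Data.Product using (_,_)
  open import Data.Sum using (inj₁; inj₂)
  open import Relation.Unary using (Decidable)
  open import Relation.Unary.Properties using (∁?)
  open import Relation.Binary.PropositionalEquality
  open import Relation.Nullary using (¬_; contradiction)

  -- In [0, N·M) a residue class modulo M has at most N elements: the quotient
  -- by M separates its elements and lies below N.
  residue-class-count : ∀ M .{{_ : NonZero M}} N r {ys : List ℕ} → Unique ys →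
    All (_< N * M) ys → All (λ y → + M ∣ℤ + y ℤ.- + r) ys → length ys ≤ N
  residue-class-count M N r {ys} ys! ys<NM ys≡r = subst (_≤ N) (length-map (_/ M) ys)
    (unique-bounded N
      (map-injectiveOn (_/ M) ys! (All.map (congruent⇒%≡ M _ r) ys≡r)
        (λ a≡r b≡r → %-/-injective M (trans a≡r (sym b≡r))))
      (All.map⁺ (All.map m<n*o⇒m/o<n ys<NM)))

  linear-difference : ∀ α β t s → (α ℤ.* t ℤ.+ β) ℤ.- (α ℤ.* s ℤ.+ β) ≡ α ℤ.* (t ℤ.- s)
  linear-difference = solve-∀

  -- A linear polynomial α t + β with p ∤ α has at most N roots modulo p^e in
  -- [0, N·p^e): they all lie in a single residue class modulo p^e.
  linear-root-count : ∀ {p} → Prime p → ∀ α → ¬ + p ∣ℤ α → ∀ e N β {ts : List ℕ} →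
    Unique ts → All (_< N * p ^ e) ts → All (λ t → + (p ^ e) ∣ℤ α ℤ.* + t ℤ.+ β) ts → length ts ≤ N
  linear-root-count _ _ _ e N β {[]} _ _ _ = z≤n
  linear-root-count {p} p-prime α p∤α e N β {t₀ ∷ _} ts! ts<Npᵉ roots@(t₀-root ∷ _) =
    residue-class-count (p ^ e) N t₀ ts! ts<Npᵉ (All.map congruent-to-t₀ roots)
    where
    instance _ = m^n≢0 p e {{prime⇒nonZero p-prime}}
    congruent-to-t₀ : ∀ {t} → + (p ^ e) ∣ℤ α ℤ.* + t ℤ.+ β → + (p ^ e) ∣ℤ + t ℤ.- + t₀
    congruent-to-t₀ {t} t-root = prime-power-cancel p-prime p∤α e _
      (subst (p ^ e ∣_) (trans (cong ∣_∣ (linear-difference α β (+ t) (+ t₀))) (ℤ.abs-* α _))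
        (∣ℤ-difference {+ (p ^ e)} (α ℤ.* + t ℤ.+ β) (α ℤ.* + t₀ ℤ.+ β) t-root t₀-root))

  quad : ℤ → ℤ → ℤ → ℤ → ℤ
  quad α β γ t = α ℤ.* t ℤ.* t ℤ.+ β ℤ.* t ℤ.+ γ

  -- Its values differ by (t − s)(α t + α s + β). The ring solver needs the
  -- statement with quad unfolded.
  quad-difference : ∀ α β γ t s →
    quad α β γ t ℤ.- quad α β γ s ≡ (t ℤ.- s) ℤ.* (α ℤ.* t ℤ.+ (α ℤ.* s ℤ.+ β))
  quad-difference = expanded
    where
    expanded : ∀ α β γ t s →
      (α ℤ.* t ℤ.* t ℤ.+ β ℤ.* t ℤ.+ γ) ℤ.- (α ℤ.* s ℤ.* s ℤ.+ β ℤ.* s ℤ.+ γ)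
        ≡ (t ℤ.- s) ℤ.* (α ℤ.* t ℤ.+ (α ℤ.* s ℤ.+ β))
    expanded = solve-∀

  -- Roots of a quadratic modulo m = p^(j+1+k). Splitting the exponent this way
  -- matches the two classes of roots counted below.
  module QuadraticRoots {p} (p-prime : Prime p) (j k : ℕ) where

    m : ℕ
    m = p ^ (suc j + k)

    m≡pᵏ*pʲ⁺¹ : m ≡ p ^ k * p ^ suc j
    m≡pᵏ*pʲ⁺¹ = trans (^-distribˡ-+-* p (suc j) k) (*-comm (p ^ suc j) (p ^ k))

    m≡pʲ*pᵏ⁺¹ : m ≡ p ^ j * p ^ suc k
    m≡pʲ*pᵏ⁺¹ = trans (cong (p ^_) (sym (+-suc j k))) (^-distribˡ-+-* p j (suc k))

    distant-root : ∀ α β γ t t₀ → + m ∣ℤ quad α β γ (+ t) → + m ∣ℤ quad α β γ (+ t₀) →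
      ¬ + (p ^ suc j) ∣ℤ + t ℤ.- + t₀ → + (p ^ suc k) ∣ℤ α ℤ.* + t ℤ.+ (α ℤ.* + t₀ ℤ.+ β)
    distant-root α β γ t t₀ t-root t₀-root not-close with
      prime-power-split p-prime (suc j) k ∣ + t ℤ.- + t₀ ∣ ∣ α ℤ.* + t ℤ.+ (α ℤ.* + t₀ ℤ.+ β) ∣
        (subst (m ∣_)
          (trans (cong ∣_∣ (quad-difference α β γ (+ t) (+ t₀))) (ℤ.abs-* (+ t ℤ.- + t₀) _))
          (∣ℤ-difference {+ m} (quad α β γ (+ t)) (quad α β γ (+ t₀)) t-root t₀-root))
    ... | inj₁ close        = contradiction close not-close
    ... | inj₂ pᵏ⁺¹∣second = pᵏ⁺¹∣second

    -- A quadratic α t² + β t + γ with p ∤ α has at most p^k + p^j roots modulo m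
    -- in [0, m). Fix a root t₀: the roots congruent to t₀ modulo p^(j+1) form one
    -- residue class (≤ p^k of them); the others are roots modulo p^(k+1) of the
    -- linear polynomial α t + α t₀ + β (≤ p^j of them).
    quadratic-root-count : ∀ α → ¬ + p ∣ℤ α → ∀ β γ {ts : List ℕ} → Unique ts →
      All (_< m) ts → All (λ t → + m ∣ℤ quad α β γ (+ t)) ts → length ts ≤ p ^ k + p ^ j
    quadratic-root-count _ _ _ _ {[]} _ _ _ = z≤n
    quadratic-root-count α p∤α β γ {ts@(t₀ ∷ _)} ts! ts<m roots@(t₀-root ∷ _) = begin
      length ts                                ≡⟨ length-split near? ts ⟩
      length (filter near? ts) + length far    ≤⟨ +-mono-≤ near-count far-count ⟩
      p ^ k + p ^ j                            ∎
      where
      open ≤-Reasoning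
      near? : Decidable (λ t → + (p ^ suc j) ∣ℤ + t ℤ.- + t₀)
      near? t = p ^ suc j ∣? ∣ + t ℤ.- + t₀ ∣
      far : List ℕ
      far = filter (∁? near?) ts
      instance _ = m^n≢0 p (suc j) {{prime⇒nonZero p-prime}}
      near-count : length (filter near? ts) ≤ p ^ k
      near-count = residue-class-count (p ^ suc j) (p ^ k) t₀ (Unique.filter⁺ near? ts!)
        (All.map (λ {t} → subst (t <_) m≡pᵏ*pʲ⁺¹) (All.filter⁺ near? ts<m))
        (All.all-filter near? ts)
      far-count : length far ≤ p ^ j
      far-count = linear-root-count p-prime α p∤α (suc k) (p ^ j) (α ℤ.* + t₀ ℤ.+ β)
        (Unique.filter⁺ (∁? near?) ts!)
        (All.map (λ {t} → subst (t <_) m≡pʲ*pᵏ⁺¹) (All.filter⁺ (∁? near?) ts<m))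
        (All.zipWith (λ {t} (t-root , t-far) → distant-root α β γ t t₀ t-root t₀-root t-far)
          (All.filter⁺ (∁? near?) roots , All.all-filter (∁? near?) ts))

module Charts where

  open Counting
  open Congruences
  open Roots
  open import Data.Bool using (Bool; T)
  open import Data.Nat as ℕ using (ℕ; _+_; _*_; _^_; _≤_; _<_; _≟_; nonTrivial⇒≢1)
  open import Data.Nat.Properties using (≤-trans; m≤m+n; +-mono-<; +-cancelʳ-≡)
  open import Data.Nat.Divisibility using (_∣_; _∣?_; ∣1⇒≡1)
  open import Data.Nat.Primality using (Prime; prime⇒nonTrivial)
  open import Data.Nat.GCD using (gcd-greatest)
  open import Data.Integer as ℤ using (ℤ; +_; ∣_∣)
  import Data.Integer.Properties as ℤ
  open import Data.Integer.Divisibility using () renaming (_∣_ to _∣ℤ_)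
  open import Data.Integer.Tactic.RingSolver using (solve-∀)
  open import Data.List
    using (List; []; _∷_; _++_; length; map; concatMap; cartesianProduct; filterᵇ; upTo)
  open import Data.List.Properties using (length-map; length-filter)
  open import Data.List.Relation.Unary.All as All using (All)
  import Data.List.Relation.Unary.All.Properties as All
  open import Data.List.Relation.Unary.Unique.Propositional using (Unique)
  import Data.List.Relation.Unary.Unique.Propositional.Properties as Unique
  open import Data.List.Membership.Propositional.Properties using (∈-upTo⁻)
  open import Data.Product using (_×_; _,_; proj₁; proj₂)
  open import Relation.Binary.PropositionalEquality
  open import Relation.Nullary using (¬_; Dec; yes; no; does)
  open import Data.Bool.Properties using (T?)
  open import Function using (_∘_)

  InBox : ℕ → ℕ × ℕ → Set
  InBox m (x , y) = x < m × y < m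

  -- A presentation of the form Q on the box [0, m)² as a quadratic polynomial in a
  -- "vertical" coordinate σ, whose leading coefficient α is prime to p and whose
  -- other coefficients depend only on a "horizontal" coordinate π < 2m.
  record QuadraticChart (p m : ℕ) (Q : ℤ → ℤ → ℤ) : Set where
    field
      π σ : ℕ × ℕ → ℕ
      α : ℤ
      β γ : ℕ → ℤ
      α-unit : ¬ + p ∣ℤ α
      Q≡quad : ∀ z → Q (+ proj₁ z) (+ proj₂ z) ≡ quad α (β (π z)) (γ (π z)) (+ σ z)
      π-bound : ∀ z → InBox m z → π z < m + m
      σ-bound : ∀ z → InBox m z → σ z < m
      coordinates-injective : ∀ {u v} → π u ≡ π v → σ u ≡ σ v → u ≡ v

  pairsMod≡cartesianProduct : ∀ m → pairsMod m ≡ cartesianProduct (upTo m) (upTo m)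
  pairsMod≡cartesianProduct m = go (upTo m)
    where
    go : ∀ xs →
      concatMap (λ x → map (λ y → (x , y)) (upTo m)) xs ≡ cartesianProduct xs (upTo m)
    go [] = refl
    go (x ∷ xs) = cong (map (x ,_) (upTo m) ++_) (go xs)

  pairsMod-unique : ∀ m → Unique (pairsMod m)
  pairsMod-unique m = subst Unique (sym (pairsMod≡cartesianProduct m))
    (Unique.cartesianProduct⁺ (Unique.upTo⁺ m) (Unique.upTo⁺ m))

  pairsMod-in-box : ∀ m → All (InBox m) (pairsMod m)
  pairsMod-in-box m = subst (All (InBox m)) (sym (pairsMod≡cartesianProduct m))
    (All.cartesianProduct⁺ (setoid ℕ) (setoid ℕ) (upTo m) (upTo m)
      (λ x∈ y∈ → ∈-upTo⁻ x∈ , ∈-upTo⁻ y∈))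

  does-sound : ∀ {P : Set} (P? : Dec P) → T (does P?) → P
  does-sound (yes p) _ = p

  -- Counting the zeros of Q fibre by fibre over π: each fibre consists of roots
  -- of a quadratic in σ, hence ρ_Q(m) ≤ 2m · (p^k + p^j) for m = p^(j+1+k).
  module _ {p} (p-prime : Prime p) (j k : ℕ) where

    open QuadraticRoots p-prime j k

    chart-count : ∀ {Q} → QuadraticChart p m Q → ρ Q m ≤ (m + m) * (p ^ k + p ^ j)
    chart-count {Q} chart = count-zeros _ (λ x y → does-sound (m ∣? ∣ Q (+ x) (+ y) ∣))
      where
      open QuadraticChart chart
      count-zeros : (g : ℕ × ℕ → Bool) → (∀ x y → T (g (x , y)) → + m ∣ℤ Q (+ x) (+ y)) →
        length (filterᵇ g (pairsMod m)) ≤ (m + m) * (p ^ k + p ^ j)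
      count-zeros g g-sound = fibre-count π (p ^ k + p ^ j) (m + m) zeros
        (All.map (π-bound _) in-box) fibre-bound
        where
        zeros : List (ℕ × ℕ)
        zeros = filterᵇ g (pairsMod m)
        zeros! : Unique zeros
        zeros! = Unique.filter⁺ (T? ∘ g) (pairsMod-unique m)
        in-box : All (InBox m) zeros
        in-box = All.filter⁺ (T? ∘ g) (pairsMod-in-box m)
        are-zeros : All (λ z → + m ∣ℤ Q (+ proj₁ z) (+ proj₂ z)) zeros
        are-zeros = All.map (λ {z} → g-sound (proj₁ z) (proj₂ z))
          (All.all-filter (T? ∘ g) (pairsMod m))
        fibre-bound : ∀ r → length (fibre π r zeros) ≤ p ^ k + p ^ j
        fibre-bound r = subst (_≤ p ^ k + p ^ j) (length-map σ F)
          (quadratic-root-count α α-unit (β r) (γ r) σ-distinct σ<m σ-roots)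
          where
          F : List (ℕ × ℕ)
          F = fibre π r zeros
          over-r : All (λ z → π z ≡ r) F
          over-r = All.all-filter (λ z → π z ≟ r) zeros
          σ-distinct : Unique (map σ F)
          σ-distinct = map-injectiveOn σ (Unique.filter⁺ (λ z → π z ≟ r) zeros!) over-r
            (λ πu≡r πv≡r → coordinates-injective (trans πu≡r (sym πv≡r)))
          σ<m : All (_< m) (map σ F)
          σ<m = All.map⁺ (All.map (σ-bound _) (All.filter⁺ (λ z → π z ≟ r) in-box))
          σ-roots : All (λ t → + m ∣ℤ quad α (β r) (γ r) (+ t)) (map σ F)
          σ-roots = All.map⁺ (All.zipWith
            (λ {z} (πz≡r , z-zero) → subst (λ w → + m ∣ℤ w)
              (trans (Q≡quad z) (cong (λ s → quad α (β s) (γ s) (+ σ z)) πz≡r)) z-zero)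
            (over-r , All.filter⁺ (λ z → π z ≟ r) are-zeros))

  quadratic-in-y : ∀ a b c x y K → a ℤ.* x ℤ.* x ℤ.+ b ℤ.* x ℤ.* y ℤ.+ c ℤ.* y ℤ.* y ℤ.- K ≡
    c ℤ.* y ℤ.* y ℤ.+ (b ℤ.* x) ℤ.* y ℤ.+ (a ℤ.* x ℤ.* x ℤ.- K)
  quadratic-in-y = solve-∀

  quadratic-in-x : ∀ a b c x y K → a ℤ.* x ℤ.* x ℤ.+ b ℤ.* x ℤ.* y ℤ.+ c ℤ.* y ℤ.* y ℤ.- K ≡
    a ℤ.* x ℤ.* x ℤ.+ (b ℤ.* y) ℤ.* x ℤ.+ (c ℤ.* y ℤ.* y ℤ.- K)
  quadratic-in-x = solve-∀

  quadratic-in-sheared-y : ∀ a b c x y K →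
    a ℤ.* x ℤ.* x ℤ.+ b ℤ.* x ℤ.* y ℤ.+ c ℤ.* y ℤ.* y ℤ.- K ≡
    (a ℤ.- b ℤ.+ c) ℤ.* y ℤ.* y ℤ.+ ((b ℤ.- a ℤ.- a) ℤ.* (x ℤ.+ y)) ℤ.* y
      ℤ.+ (a ℤ.* (x ℤ.+ y) ℤ.* (x ℤ.+ y) ℤ.- K)
  quadratic-in-sheared-y = solve-∀

  module _ {p m : ℕ} (q : BQF) (ω : ℤ) where

    horizontal-chart : ¬ + p ∣ℤ c q → QuadraticChart p m (shiftedForm q ω)
    horizontal-chart p∤c = record
      { π = proj₁ ; σ = proj₂ ; α = c q
      ; β = λ x → b q ℤ.* + x ; γ = λ x → a q ℤ.* + x ℤ.* + x ℤ.- ω ℤ.* disc q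
      ; α-unit = p∤c
      ; Q≡quad = λ (x , y) → quadratic-in-y (a q) (b q) (c q) (+ x) (+ y) (ω ℤ.* disc q)
      ; π-bound = λ _ (x<m , _) → ≤-trans x<m (m≤m+n m m)
      ; σ-bound = λ _ (_ , y<m) → y<m
      ; coordinates-injective = cong₂ _,_
      }

    vertical-chart : ¬ + p ∣ℤ a q → QuadraticChart p m (shiftedForm q ω)
    vertical-chart p∤a = record
      { π = proj₂ ; σ = proj₁ ; α = a q
      ; β = λ y → b q ℤ.* + y ; γ = λ y → c q ℤ.* + y ℤ.* + y ℤ.- ω ℤ.* disc q
      ; α-unit = p∤a
      ; Q≡quad = λ (x , y) → quadratic-in-x (a q) (b q) (c q) (+ x) (+ y) (ω ℤ.* disc q)
      ; π-bound = λ _ (_ , y<m) → ≤-trans y<m (m≤m+n m m)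
      ; σ-bound = λ _ (x<m , _) → x<m
      ; coordinates-injective = λ πu≡πv σu≡σv → cong₂ _,_ σu≡σv πu≡πv
      }

    diagonal-chart : ¬ + p ∣ℤ a q ℤ.- b q ℤ.+ c q → QuadraticChart p m (shiftedForm q ω)
    diagonal-chart p∤α = record
      { π = λ (x , y) → x + y ; σ = proj₂ ; α = a q ℤ.- b q ℤ.+ c q
      ; β = λ s → linear (+ s) ; γ = λ s → constant (+ s)
      ; α-unit = p∤α
      ; Q≡quad = λ (x , y) → trans
          (quadratic-in-sheared-y (a q) (b q) (c q) (+ x) (+ y) (ω ℤ.* disc q))
          (cong (λ s → quad (a q ℤ.- b q ℤ.+ c q) (linear s) (constant s) (+ y))
            (sym (ℤ.pos-+ x y)))
      ; π-bound = λ _ (x<m , y<m) → +-mono-< x<m y<m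
      ; σ-bound = λ _ (_ , y<m) → y<m
      ; coordinates-injective = λ {(x , y)} {(x′ , y′)} x+y≡x′+y′ y≡y′ →
          cong₂ _,_ (+-cancelʳ-≡ y x x′ (trans x+y≡x′+y′ (cong (x′ ℕ.+_) (sym y≡y′)))) y≡y′
      }
      where
      linear constant : ℤ → ℤ
      linear s = (b q ℤ.- a q ℤ.- a q) ℤ.* s
      constant s = a q ℤ.* s ℤ.* s ℤ.- ω ℤ.* disc q

  -- A primitive form has c, a or q(1, −1) = a − b + c prime to p: a prime dividing
  -- all three divides b = (a + c) − (a − b + c), hence gcd(a, b, c) = 1.
  primitive⇒unit-coefficient : ∀ {p} → Prime p → (q : BQF) → Primitive q →
    + p ∣ℤ a q → + p ∣ℤ c q → ¬ + p ∣ℤ a q ℤ.- b q ℤ.+ c q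
  primitive⇒unit-coefficient {p} p-prime q prim p∣a p∣c p∣α =
    nonTrivial⇒≢1 {{prime⇒nonTrivial p-prime}}
      (∣1⇒≡1 (subst (p ∣_) prim (gcd-greatest (gcd-greatest p∣a p∣b) p∣c)))
    where
    b-from-values : ∀ a b c → b ≡ (a ℤ.+ c) ℤ.- (a ℤ.- b ℤ.+ c)
    b-from-values = solve-∀
    p∣b : + p ∣ℤ b q
    p∣b = subst (+ p ∣ℤ_) (sym (b-from-values (a q) (b q) (c q)))
      (∣ℤ-difference {+ p} (a q ℤ.+ c q) _ (∣ℤ-sum {+ p} (a q) (c q) p∣a p∣c) p∣α)

  chart-exists : ∀ {p m} → Prime p → (q : BQF) → Primitive q → (ω : ℤ) →
    QuadraticChart p m (shiftedForm q ω)
  chart-exists {p} p-prime q prim ω with p ∣? ∣ c q ∣ | p ∣? ∣ a q ∣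
  ... | no p∤c  | _        = horizontal-chart q ω p∤c
  ... | yes _   | no p∤a   = vertical-chart q ω p∤a
  ... | yes p∣c | yes p∣a  =
    diagonal-chart q ω (primitive⇒unit-coefficient p-prime q prim p∣a p∣c)

  ρ≤pairs : ∀ Q m → ρ Q m ≤ length (pairsMod m)
  ρ≤pairs Q m = length-filter _ (pairsMod m)

module Exponents where

  open import Data.Nat using (zero; suc; z≤n; _+_; _*_; _^_; _≤_)
  open import Data.Nat.Properties
    using (≤-trans; ≤-refl; m≤m+n; +-suc; n≤1+n; m≤n⇒m<n∨m≡n;
           ^-monoˡ-≤; *-monoʳ-≤; *-monoˡ-≤; module ≤-Reasoning)
  open import Data.Nat.Tactic.RingSolver using (solve-∀)
  open import Data.Product using (_×_; _,_; ∃-syntax)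
  open import Data.Sum using (inj₁; inj₂)
  open import Relation.Binary.PropositionalEquality using (_≡_; refl; sym)

  square-bound : ∀ {r m} P → r ≤ (m + m) * (P + P) → P * P ≤ m → r ^ 2 ≤ 256 * m ^ 3
  square-bound {r} {m} P r≤4mP P²≤m = begin
    r ^ 2                      ≤⟨ ^-monoˡ-≤ 2 r≤4mP ⟩
    ((m + m) * (P + P)) ^ 2    ≡⟨ expand m P ⟩
    16 * (m * m * (P * P))     ≤⟨ *-monoʳ-≤ 16 (*-monoʳ-≤ (m * m) P²≤m) ⟩
    16 * (m * m * m)           ≤⟨ *-monoˡ-≤ (m * m * m) (m≤m+n 16 240) ⟩
    256 * (m * m * m)          ≡⟨ cube m ⟩
    256 * m ^ 3                ∎
    where
    open ≤-Reasoning
    -- x ^ 2 unfolds to x * (x * 1), the form the ring solver reads.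
    expand : ∀ m P → ((m + m) * (P + P)) * (((m + m) * (P + P)) * 1) ≡ 16 * (m * m * (P * P))
    expand = solve-∀
    cube : ∀ m → 256 * (m * m * m) ≡ 256 * (m * (m * (m * 1)))
    cube = solve-∀

  balanced-split : ∀ n → ∃[ j ] ∃[ k ] (n ≡ j + k × j ≤ k × k ≤ suc j)
  balanced-split zero = 0 , 0 , refl , z≤n , z≤n
  balanced-split (suc n) with balanced-split n
  ... | j , k , refl , j≤k , k≤1+j with m≤n⇒m<n∨m≡n j≤k
  ...   | inj₁ j<k  = suc j , k , refl , j<k , ≤-trans k≤1+j (n≤1+n (suc j))
  ...   | inj₂ refl = j , suc j , sym (+-suc j j) , n≤1+n j , ≤-refl

open Charts using (ρ≤pairs; chart-count; chart-exists)
open Exponents using (square-bound; balanced-split)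
import Data.Nat as ℕ
open import Data.Nat.Properties
  using (≤-trans; ^-monoʳ-≤; ^-monoˡ-≤; +-monoʳ-≤; +-monoˡ-≤; *-monoʳ-≤; ^-distribˡ-+-*)
open import Data.Nat.Primality using (prime⇒nonZero)
open import Data.Product using (_,_)
open import Relation.Binary.PropositionalEquality using (refl; subst)

open import Data.Nat using (ℕ; _≤_; _*_; _^_)
open import Data.Nat.Primality using (Prime)
open import Data.Integer using (ℤ; _<_; +_)

corollaryB6 : (q : BQF) → Primitive q → disc q < + 0 → (ω : ℤ) →
    (p n : ℕ) → Prime p →
    ρ (shiftedForm q ω) (p ^ n) ^ 2 ≤ 256 * (p ^ n) ^ 3
corollaryB6 q _ _ ω p ℕ.zero _ =
  ≤-trans (^-monoˡ-≤ 2 (ρ≤pairs (shiftedForm q ω) 1)) (ℕ.s≤s ℕ.z≤n)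
corollaryB6 q prim _ ω p (ℕ.suc n) p-prime with balanced-split n
... | j , k , refl , j≤k , k≤1+j = square-bound (p ^ k) ρ≤2m·2pᵏ pᵏpᵏ≤m
  where
  instance _ = prime⇒nonZero p-prime
  m : ℕ
  m = p ^ (ℕ.suc j ℕ.+ k)
  ρ≤2m·2pᵏ : ρ (shiftedForm q ω) m ≤ (m ℕ.+ m) * (p ^ k ℕ.+ p ^ k)
  ρ≤2m·2pᵏ = ≤-trans (chart-count p-prime j k (chart-exists p-prime q prim ω))
    (*-monoʳ-≤ (m ℕ.+ m) (+-monoʳ-≤ (p ^ k) (^-monoʳ-≤ p j≤k)))
  pᵏpᵏ≤m : p ^ k * p ^ k ≤ m
  pᵏpᵏ≤m = subst (_≤ m) (^-distribˡ-+-* p k k) (^-monoʳ-≤ p (+-monoˡ-≤ k k≤1+j))
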